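{- Let $X$ be a simple, connected, $3$-edge-connected graph and let $G\leq\mathrm{Aut}(X)$ be a subgroup acting semiregularly both on darts and on vertices of $X$. Then the subgroup $\Theta(G)$ of $\mathrm{Aut}(\mathrm{Jac}(X))$ is isomorphic to $G$.
   Context: A graph is a triple $(D;\sim,\lambda)$: $D$ a finite nonempty set of darts, $\sim$ an equivalence on $D$ whose classes are vertices, $\lambda$ an involution on $D$ (write $x^{ -1}=\lambda(x)$) whose orbits are edges; $I(x)$ is the class of $x$. Simple means no loops, no semiedges ($x=x^{ -1}$) and no parallel edges. An automorphism is a permutation $f$ of $D$ with $x\sim y\Rightarrow f(x)\sim f(y)$ and $\lambda f=f\lambda$. For an abelian group $A$, an $A$-flow is a map $\nu\colon D\to A$ with $\nu(x^{ -1})=-\nu(x)$ whose values generate $A$; it is harmonic if $\sum_{y\sim x}\nu(y)=0$ for every dart $x$ and the sum of $\nu$ over every oriented cycle is $0$. The Jacobian $\mathrm{Jac}(X)$ is the maximal abelian group admitting a harmonic flow (equivalently the free abelian group on a set $D^+$ of one dart per edge modulo the cycle sums and vertex sums); its order equals the number of spanning trees of $X$. Fix a harmonic flow $\xi\colon D\to\mathrm{Jac}(X)$. The homomorphism $\Theta\colon\mathrm{Aut}(X)\to\mathrm{Aut}(\mathrm{Jac}(X))$ sends $f$ to the automorphism $f^*$ given by $f^*\big(\sum_{x}c_x\xi(x)\big)=\sum_x c_x\xi(f(x))$. -}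

module Defs where

open import Data.Nat using (ℕ; zero; suc; _≤_)
open import Data.Fin using (Fin; zero; suc; inject₁; fromℕ; _≟_)
open import Data.Fin.Permutation using (Permutation′; _⟨$⟩ʳ_; _⟨$⟩ˡ_; id; flip; _∘ₚ_; _≈_)
open import Data.Integer using (ℤ; 0ℤ; 1ℤ; _+_; _-_; -_)
open import Data.Product using (Σ; _×_; ∃; _,_)
open import Data.Sum using (_⊎_)
open import Relation.Nullary using (¬_; yes; no)
open import Relation.Binary.PropositionalEquality using (_≡_; _≢_)
open import Function.Definitions using (Injective; Surjective)

-- Graphs (D ; ~ , λ).  Darts D = Fin nD (nonempty).  The equivalence ~
-- is given by a surjective labelling  vert : D → Fin nV  of darts by
-- vertices (x ~ y iff vert x ≡ vert y); I(x) = vert x.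

record Graph : Set where
  field
    nD       : ℕ
    nV       : ℕ
    nonempty : 1 ≤ nD
    vert     : Fin nD → Fin nV
    vert-surj : Surjective _≡_ _≡_ vert
    inv      : Fin nD → Fin nD
    inv-invol : ∀ x → inv (inv x) ≡ x

module _ (X : Graph) where
  open Graph X

  _∼_ : Fin nD → Fin nD → Set
  x ∼ y = vert x ≡ vert y

  -- simple: no semiedges, no loops, no parallel edges
  Simple : Set
  Simple = (∀ x → inv x ≢ x)
         × (∀ x → ¬ (x ∼ inv x))
         × (∀ x y → x ∼ y → inv x ∼ inv y → x ≡ y)

  data Walk (ok : Fin nD → Set) : Fin nV → Fin nV → Set where
    nil  : ∀ v → Walk ok v v
    cons : ∀ x {w} → ok x → Walk ok (vert (inv x)) w → Walk ok (vert x) w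

  Connected : Set
  Connected = ∀ u v → Walk (λ _ → Data.Unit.⊤) u v
    where import Data.Unit

  NotOnEdge : Fin nD → Fin nD → Set
  NotOnEdge a x = (x ≢ a) × (x ≢ inv a)

  -- removing any (at most) two edges {a,a⁻¹}, {b,b⁻¹} (a = b allowed,
  -- giving single-edge removal) leaves the graph connected
  ThreeEdgeConnected : Set
  ThreeEdgeConnected =
    Connected × (∀ a b u v → Walk (λ x → NotOnEdge a x × NotOnEdge b x) u v)

  IsAut : Permutation′ nD → Set
  IsAut f = (∀ x y → x ∼ y → (f ⟨$⟩ʳ x) ∼ (f ⟨$⟩ʳ y))
          × (∀ x → inv (f ⟨$⟩ʳ x) ≡ f ⟨$⟩ʳ (inv x))

  record IsSubgroupAut (G : Permutation′ nD → Set) : Set where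
    field
      aut   : ∀ f → G f → IsAut f
      resp  : ∀ f g → f ≈ g → G f → G g
      idG   : G id
      compG : ∀ f g → G f → G g → G (f ∘ₚ g)
      invG  : ∀ f → G f → G (flip f)

  SemiregularDarts : (Permutation′ nD → Set) → Set
  SemiregularDarts G = ∀ f → G f → ∀ x → f ⟨$⟩ʳ x ≡ x → f ≈ id

  SemiregularVertices : (Permutation′ nD → Set) → Set
  SemiregularVertices G = ∀ f → G f → ∀ x → (f ⟨$⟩ʳ x) ∼ x → f ≈ id

  -- The Jacobian, by its presentation: ℤ-vectors on darts (a vector c
  -- stands for Σ c_x ξ(x)) modulo the subgroup generated by
  -- e_x + e_{x⁻¹}, the vertex sums and the oriented-cycle sums.

  Vec : Set
  Vec = Fin nD → ℤ

  ind : Fin nD → Vec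
  ind x y with x ≟ y
  ... | yes _ = 1ℤ
  ... | no  _ = 0ℤ

  vind : Fin nV → Vec
  vind v y with vert y ≟ v
  ... | yes _ = 1ℤ
  ... | no  _ = 0ℤ

  sumFin : ∀ {k} → (Fin k → Vec) → Vec
  sumFin {zero}  c y = 0ℤ
  sumFin {suc k} c y = c zero y + sumFin (λ i → c (suc i)) y

  record Cycle : Set where
    field
      len    : ℕ
      dart   : Fin (suc len) → Fin nD
      chain  : ∀ (i : Fin len) → inv (dart (inject₁ i)) ∼ dart (suc i)
      close  : inv (dart (fromℕ len)) ∼ dart zero
      distinct : Injective _≡_ _≡_ (λ i → vert (dart i))

  cycleVec : Cycle → Vec
  cycleVec C = sumFin (λ i → ind (Cycle.dart C i))

  data Relator : Vec → Set where
    antisym : ∀ x → Relator (λ y → ind x y + ind (inv x) y)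
    vertexR : ∀ v → Relator (vind v)
    cycleR  : ∀ C → Relator (cycleVec C)

  data InSpan : Vec → Set where
    gen  : ∀ c → Relator c → InSpan c
    zer  : InSpan (λ _ → 0ℤ)
    add  : ∀ c d → InSpan c → InSpan d → InSpan (λ y → c y + d y)
    neg  : ∀ c → InSpan c → InSpan (λ y → - c y)
    ext  : ∀ c d → (∀ y → c y ≡ d y) → InSpan c → InSpan d

  _≈J_ : Vec → Vec → Set
  c ≈J d = InSpan (λ y → c y - d y)

  -- Θ(f) = f* acting on Jac(X): Σ c_x ξ(x) ↦ Σ c_x ξ(f x),
  -- i.e. on coefficient vectors c ↦ c ∘ f⁻¹
  Θ : Permutation′ nD → Vec → Vec
  Θ f c y = c (f ⟨$⟩ˡ y)

  EqJacAut : (Vec → Vec) → (Vec → Vec) → Set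
  EqJacAut φ ψ = ∀ c → φ c ≈J ψ c

-- Pairing a chain c ∈ ℤ^D with the coboundary δφ of a vertex potential φ
-- kills the antisymmetry and cycle relators and turns the vertex relators
-- into chains of the form h ∘ I.  So if ξ(a) = ξ(b), then for some h and
-- all φ, δφ(a) − δφ(b) = ⟨h ∘ I, δφ⟩ = ⟨φ ∘ I, δh⟩.  Testing with the
-- indicator φ of the set S where h is maximal, the left side is ≥ −2,
-- while the right side is at most minus the number of darts leaving S,
-- which is ≥ 3 by 3-edge-connectivity unless S is everything.  Hence h is
-- constant, δφ(a) = δφ(b) for all φ, and for a simple graph testing with
-- the indicators of the end vertices of a gives a = b.  So ξ is injective
-- on darts, and f* = g* forces f = g.

module Submission where

open import Defs
open import Data.Fin.Permutation
  using (Permutation′; _≈_; permutation; _⟨$⟩ʳ_; _⟨$⟩ˡ_; inverseʳ; inverseˡ)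
open import Data.Nat using (ℕ; zero; suc; z≤n; s≤s)
open import Data.Fin using (Fin; zero; suc; inject₁; fromℕ; punchIn; _≟_)
open import Data.Fin.Properties using (punchInᵢ≢i)
open import Data.Integer
  using (ℤ; 0ℤ; 1ℤ; -1ℤ; -[1+_]; _+_; _-_; -_; _*_; _≤_; _<_; -≤+; -≤-; +≤+)
import Data.Integer.Properties as ℤ
open import Data.Integer.Tactic.RingSolver using (solve-∀)
open import Algebra.Properties.Semiring.Sum ℤ.+-*-semiring
  using (sum; sum-cong-≗; ∑-distrib-+; *-distribˡ-sum; sum-replicate-zero;
         sum-remove; sum-init-last; sum-permute)
open import Data.List using (allFin)
open import Data.List.Membership.Propositional.Properties using (∈-allFin)
open import Data.List.Relation.Unary.All using (lookup)
open import Data.List.Extrema ℤ.≤-totalOrder using (argmax; f[xs]≤f[argmax])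
open import Data.Product using (Σ-syntax; _×_; _,_; proj₁; proj₂)
open import Function using (_∘_)
open import Relation.Nullary using (¬_; yes; no; contradiction)
open import Relation.Unary using (Pred; Decidable)
open import Relation.Binary.PropositionalEquality
  using (_≡_; _≢_; _≗_; refl; sym; trans; cong; cong₂; subst; module ≡-Reasoning)

open ≡-Reasoning

sum-neg : ∀ {n} (f : Fin n → ℤ) → sum (λ i → - f i) ≡ - sum f
sum-neg f = begin
  sum (λ i → - f i)     ≡⟨ sum-cong-≗ (λ i → sym (ℤ.-1*i≡-i (f i))) ⟩
  sum (λ i → -1ℤ * f i) ≡⟨ *-distribˡ-sum -1ℤ f ⟨
  -1ℤ * sum f           ≡⟨ ℤ.-1*i≡-i (sum f) ⟩
  - sum f               ∎

sum-distrib-minus : ∀ {n} (f g : Fin n → ℤ) → sum (λ i → f i - g i) ≡ sum f - sum g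
sum-distrib-minus f g = trans (∑-distrib-+ f (-_ ∘ g)) (cong (sum f +_) (sum-neg g))

sum-mono-≤ : ∀ {n} {f g : Fin n → ℤ} → (∀ i → f i ≤ g i) → sum f ≤ sum g
sum-mono-≤ {zero}  f≤g = ℤ.≤-refl
sum-mono-≤ {suc n} f≤g = ℤ.+-mono-≤ (f≤g zero) (sum-mono-≤ (f≤g ∘ suc))

sum-single : ∀ {n} (f : Fin n → ℤ) a → (∀ i → i ≢ a → f i ≡ 0ℤ) → sum f ≡ f a
sum-single {suc n} f a vanish = begin
  sum f                     ≡⟨ sum-remove {i = a} f ⟩
  f a + sum (f ∘ punchIn a) ≡⟨ cong (f a +_) (sum-cong-≗ (λ j → vanish _ (punchInᵢ≢i a j))) ⟩
  f a + sum {n} (λ _ → 0ℤ)  ≡⟨ cong (f a +_) (sum-replicate-zero n) ⟩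
  f a + 0ℤ                  ≡⟨ ℤ.+-identityʳ (f a) ⟩
  f a                       ∎

sum-rotate : ∀ {n} (b e : Fin (suc n) → ℤ) →
  (∀ j → e (inject₁ j) ≡ b (suc j)) → e (fromℕ n) ≡ b zero → sum e ≡ sum b
sum-rotate {n} b e shift wrap = begin
  sum e                              ≡⟨ sum-init-last e ⟩
  sum (e ∘ inject₁) + e (fromℕ n)    ≡⟨ cong₂ _+_ (sum-cong-≗ shift) wrap ⟩
  sum (b ∘ suc) + b zero             ≡⟨ ℤ.+-comm (sum (b ∘ suc)) (b zero) ⟩
  sum b                              ∎

𝟙 : ∀ {a p} {A : Set a} {P : Pred A p} → Decidable P → A → ℤ
𝟙 P? x with P? x
... | yes _ = 1ℤ
... | no  _ = 0ℤ

module _ {a p} {A : Set a} {P : Pred A p} (P? : Decidable P) where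

  𝟙-yes : ∀ {x} → P x → 𝟙 P? x ≡ 1ℤ
  𝟙-yes {x} px with P? x
  ... | yes _  = refl
  ... | no ¬px = contradiction px ¬px

  𝟙-no : ∀ {x} → ¬ P x → 𝟙 P? x ≡ 0ℤ
  𝟙-no {x} ¬px with P? x
  ... | yes px = contradiction px ¬px
  ... | no _   = refl

  -1≤𝟙-𝟙 : ∀ x y → -1ℤ ≤ 𝟙 P? x - 𝟙 P? y
  -1≤𝟙-𝟙 x y with P? x | P? y
  ... | yes _ | yes _ = -≤+
  ... | yes _ | no  _ = -≤+
  ... | no  _ | yes _ = ℤ.≤-refl
  ... | no  _ | no  _ = -≤+

  𝟙-𝟙≤1 : ∀ x y → 𝟙 P? x - 𝟙 P? y ≤ 1ℤ
  𝟙-𝟙≤1 x y with P? x | P? y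
  ... | yes _ | yes _ = +≤+ z≤n
  ... | yes _ | no  _ = ℤ.≤-refl
  ... | no  _ | yes _ = -≤+
  ... | no  _ | no  _ = +≤+ z≤n

  𝟙-𝟙≡1⇒ : ∀ {x y} → 𝟙 P? x - 𝟙 P? y ≡ 1ℤ → P x
  𝟙-𝟙≡1⇒ {x} {y} eq with P? x | P? y
  ... | yes px | _     = px
  ... | no  _  | yes _ = contradiction eq λ ()
  ... | no  _  | no  _ = contradiction eq λ ()

  𝟙-𝟙≡-1⇒ : ∀ {x y} → 𝟙 P? x - 𝟙 P? y ≡ -1ℤ → P y
  𝟙-𝟙≡-1⇒ {x} {y} eq with P? x | P? y
  ... | _     | yes py = py
  ... | yes _ | no  _  = contradiction eq λ ()
  ... | no  _ | no  _  = contradiction eq λ ()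

sum-≤-3 : ∀ {n} (g : Fin n → ℤ) {a₁ a₂ a₃} → a₂ ≢ a₁ → a₃ ≢ a₁ → a₃ ≢ a₂ →
  (∀ i → g i ≤ 0ℤ) → g a₁ ≤ -1ℤ → g a₂ ≤ -1ℤ → g a₃ ≤ -1ℤ → sum g ≤ -[1+ 2 ]
sum-≤-3 g {a₁} {a₂} {a₃} a₂≢a₁ a₃≢a₁ a₃≢a₂ g≤0 g₁ g₂ g₃ =
  subst (sum g ≤_) sum-bound (sum-mono-≤ below)
  where
  bound : Fin _ → ℤ
  bound i = - 𝟙 (_≟ a₁) i + (- 𝟙 (_≟ a₂) i + - 𝟙 (_≟ a₃) i)

  sum-𝟙 : ∀ a → sum (λ i → - 𝟙 (_≟ a) i) ≡ -1ℤ
  sum-𝟙 a = trans (sum-neg (𝟙 (_≟ a)))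
                  (cong -_ (trans (sum-single _ a (λ i → 𝟙-no (_≟ a))) (𝟙-yes (_≟ a) refl)))

  sum-bound : sum bound ≡ -[1+ 2 ]
  sum-bound = begin
    sum bound
      ≡⟨ ∑-distrib-+ (λ i → - 𝟙 (_≟ a₁) i) (λ i → - 𝟙 (_≟ a₂) i + - 𝟙 (_≟ a₃) i) ⟩
    sum (λ i → - 𝟙 (_≟ a₁) i) + sum (λ i → - 𝟙 (_≟ a₂) i + - 𝟙 (_≟ a₃) i)
      ≡⟨ cong (sum (λ i → - 𝟙 (_≟ a₁) i) +_) (∑-distrib-+ (λ i → - 𝟙 (_≟ a₂) i) (λ i → - 𝟙 (_≟ a₃) i)) ⟩
    sum (λ i → - 𝟙 (_≟ a₁) i) + (sum (λ i → - 𝟙 (_≟ a₂) i) + sum (λ i → - 𝟙 (_≟ a₃) i))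
      ≡⟨ cong₂ _+_ (sum-𝟙 a₁) (cong₂ _+_ (sum-𝟙 a₂) (sum-𝟙 a₃)) ⟩
    -[1+ 2 ] ∎

  below : ∀ i → g i ≤ bound i
  below i with i ≟ a₁ | i ≟ a₂ | i ≟ a₃
  ... | yes refl | yes refl | _        = contradiction refl a₂≢a₁
  ... | yes refl | no _     | yes refl = contradiction refl a₃≢a₁
  ... | no _     | yes refl | yes refl = contradiction refl a₃≢a₂
  ... | yes refl | no _     | no _     = g₁
  ... | no _     | yes refl | no _     = g₂
  ... | no _     | no _     | yes refl = g₃
  ... | no _     | no _     | no _     = g≤0 i

module _ {n : ℕ} where

  ⟨_,_⟩ : (Fin n → ℤ) → (Fin n → ℤ) → ℤ
  ⟨ c , d ⟩ = sum (λ i → c i * d i)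

  ⟨⟩-congˡ : ∀ {c c′} d → c ≗ c′ → ⟨ c , d ⟩ ≡ ⟨ c′ , d ⟩
  ⟨⟩-congˡ d c≗c′ = sum-cong-≗ (λ i → cong (_* d i) (c≗c′ i))

  ⟨⟩-congʳ : ∀ c {d d′} → d ≗ d′ → ⟨ c , d ⟩ ≡ ⟨ c , d′ ⟩
  ⟨⟩-congʳ c d≗d′ = sum-cong-≗ (λ i → cong (c i *_) (d≗d′ i))

  ⟨⟩-comm : ∀ c d → ⟨ c , d ⟩ ≡ ⟨ d , c ⟩
  ⟨⟩-comm c d = sum-cong-≗ (λ i → ℤ.*-comm (c i) (d i))

  ⟨⟩-zeroˡ : ∀ d → ⟨ (λ _ → 0ℤ) , d ⟩ ≡ 0ℤ
  ⟨⟩-zeroˡ d = sum-replicate-zero n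

  ⟨⟩-+ˡ : ∀ c c′ d → ⟨ (λ i → c i + c′ i) , d ⟩ ≡ ⟨ c , d ⟩ + ⟨ c′ , d ⟩
  ⟨⟩-+ˡ c c′ d = trans (sum-cong-≗ (λ i → ℤ.*-distribʳ-+ (d i) (c i) (c′ i)))
                       (∑-distrib-+ (λ i → c i * d i) (λ i → c′ i * d i))

  ⟨⟩-negˡ : ∀ c d → ⟨ (λ i → - c i) , d ⟩ ≡ - ⟨ c , d ⟩
  ⟨⟩-negˡ c d = trans (sum-cong-≗ (λ i → sym (ℤ.neg-distribˡ-* (c i) (d i))))
                      (sum-neg (λ i → c i * d i))

  ⟨⟩-minusˡ : ∀ c c′ d → ⟨ (λ i → c i - c′ i) , d ⟩ ≡ ⟨ c , d ⟩ - ⟨ c′ , d ⟩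
  ⟨⟩-minusˡ c c′ d = trans (⟨⟩-+ˡ c (λ i → - c′ i) d) (cong (⟨ c , d ⟩ +_) (⟨⟩-negˡ c′ d))

  ⟨⟩-minusʳ : ∀ c d d′ → ⟨ c , (λ i → d i - d′ i) ⟩ ≡ ⟨ c , d ⟩ - ⟨ c , d′ ⟩
  ⟨⟩-minusʳ c d d′ = begin
    ⟨ c , (λ i → d i - d′ i) ⟩   ≡⟨ ⟨⟩-comm c _ ⟩
    ⟨ (λ i → d i - d′ i) , c ⟩   ≡⟨ ⟨⟩-minusˡ d d′ c ⟩
    ⟨ d , c ⟩ - ⟨ d′ , c ⟩       ≡⟨ cong₂ _-_ (⟨⟩-comm d c) (⟨⟩-comm d′ c) ⟩
    ⟨ c , d ⟩ - ⟨ c , d′ ⟩       ∎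

  ⟨⟩-permute : ∀ c d (π : Permutation′ n) → ⟨ c ∘ (π ⟨$⟩ʳ_) , d ∘ (π ⟨$⟩ʳ_) ⟩ ≡ ⟨ c , d ⟩
  ⟨⟩-permute c d π = sym (sum-permute (λ i → c i * d i) π)

  ⟨⟩-single : ∀ {c} d a → (∀ i → i ≢ a → c i ≡ 0ℤ) → ⟨ c , d ⟩ ≡ c a * d a
  ⟨⟩-single {c} d a vanish = sum-single _ a (λ i i≢a → cong (_* d i) (vanish i i≢a))

module _ {a} {A : Set a} (h : A → ℤ) {M : ℤ} (h≤M : ∀ w → h w ≤ M) where

  top? : Decidable (λ w → h w ≡ M)
  top? w = h w ℤ.≟ M

  top-drop≤0 : ∀ z t → 𝟙 top? z * (h t - h z) ≤ 0ℤ
  top-drop≤0 z t with top? z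
  ... | yes refl = ℤ.≤-trans (ℤ.≤-reflexive (ℤ.*-identityˡ _)) (ℤ.i≤j⇒i-j≤0 (h≤M t))
  ... | no _     = ℤ.≤-refl

  top-exit≤-1 : ∀ {z t} → h z ≡ M → h t ≢ M → 𝟙 top? z * (h t - h z) ≤ -1ℤ
  top-exit≤-1 {z} {t} hz≡M ht≢M with top? z
  ... | no hz≢M  = contradiction hz≡M hz≢M
  ... | yes refl = ℤ.≤-trans (ℤ.≤-reflexive (ℤ.*-identityˡ _)) (ℤ.i<j⇒i≤pred[j] difference<0)
    where
    difference<0 : h t - M < 0ℤ
    difference<0 = subst (h t - M <_) (ℤ.+-inverseʳ M)
                         (ℤ.+-monoˡ-< (- M) (ℤ.≤∧≢⇒< (h≤M t) ht≢M))

module _ (X : Graph) where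
  open Graph X

  ind-diag : ∀ x → ind X x x ≡ 1ℤ
  ind-diag x with x ≟ x
  ... | yes _  = refl
  ... | no x≢x = contradiction refl x≢x

  ind-off : ∀ {x y} → x ≢ y → ind X x y ≡ 0ℤ
  ind-off {x} {y} x≢y with x ≟ y
  ... | yes x≡y = contradiction x≡y x≢y
  ... | no _    = refl

  ⟨ind⟩ : ∀ d a → ⟨ ind X a , d ⟩ ≡ d a
  ⟨ind⟩ d a = trans (⟨⟩-single d a (λ i i≢a → ind-off (i≢a ∘ sym)))
                    (trans (cong (_* d a) (ind-diag a)) (ℤ.*-identityˡ (d a)))

  vind-𝟙 : ∀ v → vind X v ≗ 𝟙 (_≟ v) ∘ vert
  vind-𝟙 v y with vert y ≟ v
  ... | yes _ = refl
  ... | no  _ = refl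

  Θ-ind : ∀ (f : Permutation′ nD) x → Θ X f (ind X x) ≗ ind X (f ⟨$⟩ʳ x)
  Θ-ind f x y with x ≟ f ⟨$⟩ˡ y
  ... | yes refl = sym (subst (λ z → ind X z y ≡ 1ℤ) (sym (inverseʳ f)) (ind-diag y))
  ... | no x≢f⁻¹y = sym (ind-off λ fx≡y → x≢f⁻¹y (trans (sym (inverseˡ f)) (cong (f ⟨$⟩ˡ_) fx≡y)))

  δ : (Fin nV → ℤ) → Vec X
  δ φ x = φ (vert (inv x)) - φ (vert x)

  invπ : Permutation′ nD
  invπ = permutation inv inv inv-invol inv-invol

  ⟨⟩-δ-sym : ∀ φ h → ⟨ h ∘ vert , δ φ ⟩ ≡ ⟨ φ ∘ vert , δ h ⟩
  ⟨⟩-δ-sym φ h = begin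
    ⟨ h ∘ vert , δ φ ⟩
      ≡⟨ ⟨⟩-minusʳ (h ∘ vert) (φ ∘ vert ∘ inv) (φ ∘ vert) ⟩
    ⟨ h ∘ vert , φ ∘ vert ∘ inv ⟩ - ⟨ h ∘ vert , φ ∘ vert ⟩
      ≡⟨ cong (_- ⟨ h ∘ vert , φ ∘ vert ⟩) reflect ⟩
    ⟨ h ∘ vert ∘ inv , φ ∘ vert ⟩ - ⟨ h ∘ vert , φ ∘ vert ⟩
      ≡⟨ ⟨⟩-minusˡ (h ∘ vert ∘ inv) (h ∘ vert) (φ ∘ vert) ⟨
    ⟨ δ h , φ ∘ vert ⟩
      ≡⟨ ⟨⟩-comm (δ h) (φ ∘ vert) ⟩
    ⟨ φ ∘ vert , δ h ⟩ ∎
    where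
    reflect : ⟨ h ∘ vert , φ ∘ vert ∘ inv ⟩ ≡ ⟨ h ∘ vert ∘ inv , φ ∘ vert ⟩
    reflect = trans (sym (⟨⟩-permute (h ∘ vert) (φ ∘ vert ∘ inv) invπ))
                    (⟨⟩-congʳ (h ∘ vert ∘ inv) (λ x → cong (φ ∘ vert) (inv-invol x)))

  ⟨sumFin⟩ : ∀ {k} (c : Fin k → Vec X) d → ⟨ sumFin X c , d ⟩ ≡ sum (λ i → ⟨ c i , d ⟩)
  ⟨sumFin⟩ {zero}  c d = ⟨⟩-zeroˡ d
  ⟨sumFin⟩ {suc k} c d = trans (⟨⟩-+ˡ (c zero) (sumFin X (c ∘ suc)) d)
                               (cong (⟨ c zero , d ⟩ +_) (⟨sumFin⟩ (c ∘ suc) d))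

  -- Pairing with δφ computes ⟨∂c, φ⟩ for the boundary divisor ∂c, and
  -- ⟨h ∘ I, δφ⟩ = ⟨φ, Δh⟩ by ⟨⟩-δ-sym; so this says that ∂c is the principal
  -- divisor of h, without introducing divisors.
  Principal : Vec X → Set
  Principal c = Σ[ h ∈ (Fin nV → ℤ) ] ∀ φ → ⟨ c , δ φ ⟩ ≡ ⟨ h ∘ vert , δ φ ⟩

  principal-zero : ∀ {c} → (∀ φ → ⟨ c , δ φ ⟩ ≡ 0ℤ) → Principal c
  principal-zero c⊥δ = (λ _ → 0ℤ) , λ φ → trans (c⊥δ φ) (sym (⟨⟩-zeroˡ (δ φ)))

  ⟨cycle⟩ : ∀ C φ → ⟨ cycleVec X C , δ φ ⟩ ≡ 0ℤ
  ⟨cycle⟩ C φ = begin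
    ⟨ cycleVec X C , δ φ ⟩                       ≡⟨ ⟨sumFin⟩ (ind X ∘ dart) (δ φ) ⟩
    sum (λ i → ⟨ ind X (dart i) , δ φ ⟩)         ≡⟨ sum-cong-≗ (⟨ind⟩ (δ φ) ∘ dart) ⟩
    sum (λ i → δ φ (dart i))                     ≡⟨ sum-distrib-minus (φ ∘ vert ∘ inv ∘ dart) (φ ∘ vert ∘ dart) ⟩
    sum (φ ∘ vert ∘ inv ∘ dart) - sum (φ ∘ vert ∘ dart)
      ≡⟨ cong (_- sum (φ ∘ vert ∘ dart))
              (sum-rotate (φ ∘ vert ∘ dart) (φ ∘ vert ∘ inv ∘ dart) (cong φ ∘ chain) (cong φ close)) ⟩
    sum (φ ∘ vert ∘ dart) - sum (φ ∘ vert ∘ dart) ≡⟨ ℤ.+-inverseʳ (sum (φ ∘ vert ∘ dart)) ⟩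
    0ℤ                                           ∎
    where open Cycle C

  relator-principal : ∀ {c} → Relator X c → Principal c
  relator-principal {c} (antisym x) = principal-zero {c} λ φ → begin
    ⟨ (λ y → ind X x y + ind X (inv x) y) , δ φ ⟩   ≡⟨ ⟨⟩-+ˡ (ind X x) (ind X (inv x)) (δ φ) ⟩
    ⟨ ind X x , δ φ ⟩ + ⟨ ind X (inv x) , δ φ ⟩     ≡⟨ cong₂ _+_ (⟨ind⟩ (δ φ) x) (⟨ind⟩ (δ φ) (inv x)) ⟩
    δ φ x + δ φ (inv x)                             ≡⟨ cong (λ z → δ φ x + (φ (vert z) - φ (vert (inv x)))) (inv-invol x) ⟩
    δ φ x + (φ (vert x) - φ (vert (inv x)))         ≡⟨ cancel (φ (vert (inv x))) (φ (vert x)) ⟩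
    0ℤ                                              ∎
    where
    cancel : ∀ i j → (i - j) + (j - i) ≡ 0ℤ
    cancel = solve-∀
  relator-principal (vertexR v) = 𝟙 (_≟ v) , λ φ → ⟨⟩-congˡ (δ φ) (vind-𝟙 v)
  relator-principal {c} (cycleR C) = principal-zero {c} (⟨cycle⟩ C)

  inSpan⇒principal : ∀ {c} → InSpan X c → Principal c
  inSpan⇒principal (gen c r) = relator-principal r
  inSpan⇒principal {c} zer = principal-zero {c} (⟨⟩-zeroˡ ∘ δ)
  inSpan⇒principal (add c d c∈ d∈) with inSpan⇒principal c∈ | inSpan⇒principal d∈
  ... | h , ∂c≡h | k , ∂d≡k = (λ v → h v + k v) , λ φ → begin
    ⟨ (λ y → c y + d y) , δ φ ⟩                   ≡⟨ ⟨⟩-+ˡ c d (δ φ) ⟩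
    ⟨ c , δ φ ⟩ + ⟨ d , δ φ ⟩                     ≡⟨ cong₂ _+_ (∂c≡h φ) (∂d≡k φ) ⟩
    ⟨ h ∘ vert , δ φ ⟩ + ⟨ k ∘ vert , δ φ ⟩       ≡⟨ ⟨⟩-+ˡ (h ∘ vert) (k ∘ vert) (δ φ) ⟨
    ⟨ (λ y → h (vert y) + k (vert y)) , δ φ ⟩     ∎
  inSpan⇒principal (neg c c∈) with inSpan⇒principal c∈
  ... | h , ∂c≡h = (λ v → - h v) , λ φ → begin
    ⟨ (λ y → - c y) , δ φ ⟩          ≡⟨ ⟨⟩-negˡ c (δ φ) ⟩
    - ⟨ c , δ φ ⟩                    ≡⟨ cong -_ (∂c≡h φ) ⟩
    - ⟨ h ∘ vert , δ φ ⟩             ≡⟨ ⟨⟩-negˡ (h ∘ vert) (δ φ) ⟨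
    ⟨ (λ y → - h (vert y)) , δ φ ⟩   ∎
  inSpan⇒principal (ext c d c≗d c∈) with inSpan⇒principal c∈
  ... | h , ∂c≡h = h , λ φ → trans (sym (⟨⟩-congˡ (δ φ) c≗d)) (∂c≡h φ)

  Leaves : (Fin nV → Set) → Fin nD → Set
  Leaves P x = P (vert x) × ¬ P (vert (inv x))

  walk-leaves : ∀ {ok P} → Decidable P → ∀ {u v} → Walk X ok u v → P u → ¬ P v →
    Σ[ x ∈ Fin nD ] ok x × Leaves P x
  walk-leaves P? (nil _) Pu ¬Pv = contradiction Pu ¬Pv
  walk-leaves P? (cons x okx w) Pu ¬Pv with P? (vert (inv x))
  ... | yes Pt = walk-leaves P? w Pt ¬Pv
  ... | no ¬Pt = x , okx , Pu , ¬Pt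

  record ThreeLeavingDarts (P : Fin nV → Set) : Set where
    field
      x₁ x₂ x₃ : Fin nD
      leaves₁  : Leaves P x₁
      leaves₂  : Leaves P x₂
      leaves₃  : Leaves P x₃
      x₂≢x₁    : x₂ ≢ x₁
      x₃≢x₁    : x₃ ≢ x₁
      x₃≢x₂    : x₃ ≢ x₂

  three-leaving-darts : ThreeEdgeConnected X → ∀ {P} → Decidable P → ∀ {u v} → P u → ¬ P v →
    ThreeLeavingDarts P
  three-leaving-darts (connected , robust) P? Pu ¬Pv =
    record { leaves₁ = leaves₁ ; leaves₂ = leaves₂ ; leaves₃ = leaves₃
           ; x₂≢x₁ = proj₁ x₂∉x₁ ; x₃≢x₁ = proj₁ x₃∉x₁ ; x₃≢x₂ = proj₁ x₃∉x₂ }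
    where
    first = walk-leaves P? (connected _ _) Pu ¬Pv
    x₁ = proj₁ first
    leaves₁ = proj₂ (proj₂ first)
    second = walk-leaves P? (robust x₁ x₁ _ _) Pu ¬Pv
    x₂∉x₁ = proj₁ (proj₁ (proj₂ second))
    leaves₂ = proj₂ (proj₂ second)
    third = walk-leaves P? (robust x₁ (proj₁ second) _ _) Pu ¬Pv
    x₃∉x₁ = proj₁ (proj₁ (proj₂ third))
    x₃∉x₂ = proj₂ (proj₁ (proj₂ third))
    leaves₃ = proj₂ (proj₂ third)

  ⟨top,δ⟩≤-3 : ThreeEdgeConnected X → ∀ h {M} (h≤M : ∀ w → h w ≤ M) {u v} → h u ≡ M → h v ≢ M →
    ⟨ 𝟙 (top? h h≤M) ∘ vert , δ h ⟩ ≤ -[1+ 2 ]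
  ⟨top,δ⟩≤-3 tec h h≤M hu≡M hv≢M =
    sum-≤-3 (λ y → 𝟙 (top? h h≤M) (vert y) * δ h y) x₂≢x₁ x₃≢x₁ x₃≢x₂
      (λ y → top-drop≤0 h h≤M (vert y) (vert (inv y)))
      (exit leaves₁) (exit leaves₂) (exit leaves₃)
    where
    open ThreeLeavingDarts (three-leaving-darts tec (top? h h≤M) hu≡M hv≢M)
    exit : ∀ {x} → Leaves (λ w → h w ≡ _) x → 𝟙 (top? h h≤M) (vert x) * δ h x ≤ -1ℤ
    exit (hs≡M , ht≢M) = top-exit≤-1 h h≤M hs≡M ht≢M

  -2≤δ-δ : ∀ {P : Fin nV → Set} (P? : Decidable P) a b → -[1+ 1 ] ≤ δ (𝟙 P?) a - δ (𝟙 P?) b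
  -2≤δ-δ P? a b = ℤ.+-mono-≤ (-1≤𝟙-𝟙 P? _ _) (ℤ.neg-mono-≤ (𝟙-𝟙≤1 P? _ _))

  dart-potential-constant : ThreeEdgeConnected X → ∀ a b h →
    (∀ φ → δ φ a - δ φ b ≡ ⟨ φ ∘ vert , δ h ⟩) → ∀ v w → h v ≡ h w
  dart-potential-constant tec a b h pairing v w = trans (on-top v) (sym (on-top w))
    where
    top = argmax h (vert a) (allFin nV)
    h≤top : ∀ w → h w ≤ h top
    h≤top w = lookup (f[xs]≤f[argmax] (vert a) (allFin nV)) (∈-allFin w)
    on-top : ∀ v → h v ≡ h top
    on-top v with h v ℤ.≟ h top
    ... | yes hv≡M = hv≡M
    ... | no hv≢M  = contradiction
      (ℤ.≤-trans (subst (-[1+ 1 ] ≤_) (pairing (𝟙 (top? h h≤top))) (-2≤δ-δ (top? h h≤top) a b))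
                 (⟨top,δ⟩≤-3 tec h h≤top refl hv≢M))
      λ { (-≤- (s≤s ())) }

  coboundaries-separate-darts : Simple X → ∀ {a b} → (∀ φ → δ φ a ≡ δ φ b) → a ≡ b
  coboundaries-separate-darts (_ , loopless , no-parallel) {a} {b} δa≡δb =
    no-parallel a b (sym same-source) (sym same-target)
    where
    same-target : vert (inv b) ≡ vert (inv a)
    same-target = 𝟙-𝟙≡1⇒ (_≟ vert (inv a)) {y = vert b}
      (trans (sym (δa≡δb (𝟙 (_≟ vert (inv a)))))
             (cong₂ _-_ (𝟙-yes (_≟ vert (inv a)) refl) (𝟙-no (_≟ vert (inv a)) (loopless a))))
    same-source : vert b ≡ vert a
    same-source = 𝟙-𝟙≡-1⇒ (_≟ vert a) {x = vert (inv b)}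
      (trans (sym (δa≡δb (𝟙 (_≟ vert a))))
             (cong₂ _-_ (𝟙-no (_≟ vert a) (loopless a ∘ sym)) (𝟙-yes (_≟ vert a) refl)))

  ξ-injective : Simple X → ThreeEdgeConnected X → ∀ {a b} → _≈J_ X (ind X a) (ind X b) → a ≡ b
  ξ-injective simple tec {a} {b} ξa≈ξb = coboundaries-separate-darts simple same-coboundary
    where
    h = proj₁ (inSpan⇒principal ξa≈ξb)
    pairing : ∀ φ → δ φ a - δ φ b ≡ ⟨ φ ∘ vert , δ h ⟩
    pairing φ = begin
      δ φ a - δ φ b                                   ≡⟨ cong₂ _-_ (⟨ind⟩ (δ φ) a) (⟨ind⟩ (δ φ) b) ⟨
      ⟨ ind X a , δ φ ⟩ - ⟨ ind X b , δ φ ⟩           ≡⟨ ⟨⟩-minusˡ (ind X a) (ind X b) (δ φ) ⟨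
      ⟨ (λ y → ind X a y - ind X b y) , δ φ ⟩         ≡⟨ proj₂ (inSpan⇒principal ξa≈ξb) φ ⟩
      ⟨ h ∘ vert , δ φ ⟩                              ≡⟨ ⟨⟩-δ-sym φ h ⟩
      ⟨ φ ∘ vert , δ h ⟩                              ∎
    δh≗0 : δ h ≗ λ _ → 0ℤ
    δh≗0 y = ℤ.i≡j⇒i-j≡0 (dart-potential-constant tec a b h pairing _ _)
    same-coboundary : ∀ φ → δ φ a ≡ δ φ b
    same-coboundary φ = ℤ.i-j≡0⇒i≡j _ _ (begin
      δ φ a - δ φ b             ≡⟨ pairing φ ⟩
      ⟨ φ ∘ vert , δ h ⟩        ≡⟨ ⟨⟩-congʳ (φ ∘ vert) δh≗0 ⟩
      ⟨ φ ∘ vert , (λ _ → 0ℤ) ⟩ ≡⟨ ⟨⟩-comm (φ ∘ vert) _ ⟩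
      ⟨ (λ _ → 0ℤ) , φ ∘ vert ⟩ ≡⟨ ⟨⟩-zeroˡ (φ ∘ vert) ⟩
      0ℤ                        ∎)

theorem4p3 : (X : Graph) → Simple X → Connected X → ThreeEdgeConnected X →
    (G : Permutation′ (Graph.nD X) → Set) → IsSubgroupAut X G →
    SemiregularDarts X G → SemiregularVertices X G →
    ∀ f g → G f → G g → EqJacAut X (Θ X f) (Θ X g) → f ≈ g
theorem4p3 X simple _ tec _ _ _ _ f g _ _ f*≈g* x =
  ξ-injective X simple tec
    (ext _ _ (λ y → cong₂ _-_ (Θ-ind X f x y) (Θ-ind X g x y)) (f*≈g* (ind X x)))
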